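{- Let $p,r\geq1$ and $n\geq2$. Then $\Delta(O\Gamma_{n}^{(p,r)})=\Delta(I\Gamma_{n}^{(p,r)})=n$ and $d_{O\Gamma_{n}^{(p,r)}}(0^{n})=d_{I\Gamma_{n}^{(p,r)}}(0^{n})=n$. Moreover, $0^{n}$ is the only vertex of degree $\Delta(O\Gamma_{n}^{(p,r)})$ in $O\Gamma_{n}^{(p,r)}$ if and only if one of the following holds: (a) $p\geq1$, $r=1$ and $n\geq2$; (b) $p\geq2$, $r\geq2$ and $n\geq2$. And $0^{n}$ is the only vertex of degree $\Delta(I\Gamma_{n}^{(p,r)})$ in $I\Gamma_{n}^{(p,r)}$ if and only if one of the following holds: (a') $p\geq1$, $r=1$ and $n\geq2$; (b') $p\geq2$, $r=2$ and $n\geq 4$; (c') $p\geq2$, $r\geq3$ and $n\geq 5$.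
   Context: For positive integers $n,p,r$: $O\Gamma_{n}^{(p,r)}$ is the graph whose vertices are the binary words of length $n$ in which any two $1$s are separated by at least $p-1$ zeros and which contain no factor $(10^{p-1})^{r}1$ (no more than $r$ ones each separated from the next by exactly $p-1$ zeros); $I\Gamma_{n}^{(p,r)}$ is the graph whose vertices are the binary words of length $n$ in which every maximal block of consecutive $1$s has length at most $r$ and any two distinct blocks of $1$s are separated by at least $p$ zeros. In both, two vertices are adjacent iff they differ in exactly one coordinate. $\Delta(G)$ is the maximum degree, $d_G(v)$ the degree of $v$, and $0^n$ the all-zero word of length $n$. -}

module Defs where

open import Data.Bool using (Bool; true; false; _∧_; _∨_; not; if_then_else_)
open import Data.Nat using (ℕ; zero; suc; _+_; _∸_; _⊔_; _≡ᵇ_)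
open import Data.List using (List; []; _∷_; _++_; replicate; concat; map; filterᵇ; length; upTo; foldr)

all : {A : Set} → (A → Bool) → List A → Bool
all p = foldr (λ x b → p x ∧ b) true

-- Binary words are lists of booleans (true = 1, false = 0).
Word : Set
Word = List Bool

words : ℕ → List Word
words zero    = [] ∷ []
words (suc n) = map (false ∷_) (words n) ++ map (true ∷_) (words n)

isPrefix : Word → Word → Bool
isPrefix []       _        = true
isPrefix (_ ∷ _)  []       = false
isPrefix (x ∷ xs) (y ∷ ys) = (if x then y else not y) ∧ isPrefix xs ys

isFactor : Word → Word → Bool
isFactor u []       = isPrefix u []
isFactor u (y ∷ ys) = isPrefix u (y ∷ ys) ∨ isFactor u ys

oneZerosOne : ℕ → Word
oneZerosOne j = true ∷ replicate j false ++ true ∷ []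

-- O-vertices: any two 1s separated by at least p-1 zeros
-- (no factor 1 0^j 1 with j < p-1) and no factor (1 0^{p-1})^r 1.
isOWord : ℕ → ℕ → Word → Bool
isOWord p r w =
  all (λ j → not (isFactor (oneZerosOne j) w)) (upTo (p ∸ 1))
  ∧ not (isFactor (concat (replicate r (true ∷ replicate (p ∸ 1) false)) ++ true ∷ []) w)

-- I-vertices: every maximal block of 1s has length ≤ r (no factor 1^{r+1})
-- and distinct blocks of 1s are separated by at least p zeros
-- (no factor 1 0^j 1 with 1 ≤ j < p).
isIWord : ℕ → ℕ → Word → Bool
isIWord p r w =
  not (isFactor (replicate (suc r) true) w)
  ∧ all (λ j → not (isFactor (oneZerosOne (suc j)) w)) (upTo (p ∸ 1))

OV : ℕ → ℕ → ℕ → List Word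
OV n p r = filterᵇ (isOWord p r) (words n)

IV : ℕ → ℕ → ℕ → List Word
IV n p r = filterᵇ (isIWord p r) (words n)

ham : Word → Word → ℕ
ham []       _        = 0
ham (_ ∷ _)  []       = 0
ham (x ∷ xs) (y ∷ ys) = (if x then (if y then 0 else 1) else (if y then 1 else 0)) + ham xs ys

deg : List Word → Word → ℕ
deg V v = length (filterᵇ (λ w → ham v w ≡ᵇ 1) V)

Δ : List Word → ℕ
Δ V = foldr (λ v m → deg V v ⊔ m) 0 V

zeroWord : ℕ → Word
zeroWord n = replicate n false

-- Both graphs are induced subgraphs of the n-cube containing every word of weight at most 1.
-- Hence Δ ≤ n, and 0^n keeps all n of its cube neighbours, so Δ = n; a vertex has degree n
-- exactly when all its cube neighbours are vertices.  If 11 is forbidden (r = 1, or p ≥ 2 for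
-- O-words), flipping a bit next to the first 1 of a nonzero vertex creates 11, so 0^n is the
-- only vertex of degree n.  For I-words with p ≥ 2 the forbidden factor 101 plays the same
-- role once n ≥ 5, or n ≥ 4 when r = 2 also forbids 111.  In all other cases some nonzero
-- vertex has only vertices as neighbours: 10^(n-1) when p = 1, and 10, 010, 0110 for small n.
module Submission where

open import Defs
open import Data.Bool using (Bool; true; false; _∧_; _∨_; not; T)
open import Data.Bool.Properties using (∧-zeroʳ; ∨-zeroʳ; T-≡)
open import Data.List using (List; []; _∷_; _++_; replicate; concat; map; filterᵇ; length; foldr; upTo)
open import Data.List.Properties
  using (length-++; length-map; length-replicate; filter-++; filter-all; filter-notAll; length-filter)
open import Data.List.Membership.Propositional using (_∈_; lose)
open import Data.List.Membership.Propositional.Properties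
  using (∈-map⁺; ∈-map⁻; ∈-++⁺ˡ; ∈-++⁺ʳ; ∈-++⁻; ∈-filter⁺; ∈-filter⁻)
open import Data.List.Relation.Unary.All as All using (All; []; _∷_)
open import Data.List.Relation.Unary.Any using (Any; here; there)
open import Data.Nat using (ℕ; zero; suc; _+_; _∸_; _⊔_; _≡ᵇ_; _≤_; _<_; z≤n; s≤s)
open import Data.Nat.Combinatorics using (_C_; nC1≡n; nCk+nC[k+1]≡[n+1]C[k+1])
open import Data.Nat.Properties
open import Data.Product using (_×_; _,_; proj₁; ∃-syntax)
open import Data.Sum as Sum using (_⊎_; inj₁; inj₂)
open import Function.Base using (_∘_)
open import Function.Bundles using (_⇔_; mk⇔; Equivalence)
open import Relation.Binary.PropositionalEquality
open import Relation.Nullary using (¬_; contradiction)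
open import Relation.Nullary.Decidable using (T?)

private
  variable
    A B : Set

  ≡true⇒T : ∀ {b} → b ≡ true → T b
  ≡true⇒T = Equivalence.from T-≡

  ≡false⇒¬T : ∀ {b} → b ≡ false → ¬ T b
  ≡false⇒¬T refl ()

filterᵇ-comm : ∀ (P Q : A → Bool) xs → filterᵇ P (filterᵇ Q xs) ≡ filterᵇ Q (filterᵇ P xs)
filterᵇ-comm P Q [] = refl
filterᵇ-comm P Q (x ∷ xs) with P x in px | Q x in qx
... | true  | true  rewrite px | qx = cong (x ∷_) (filterᵇ-comm P Q xs)
... | true  | false rewrite qx      = filterᵇ-comm P Q xs
... | false | true  rewrite px      = filterᵇ-comm P Q xs
... | false | false                 = filterᵇ-comm P Q xs

filterᵇ-map : ∀ (P : B → Bool) (f : A → B) xs → filterᵇ P (map f xs) ≡ map f (filterᵇ (P ∘ f) xs)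
filterᵇ-map P f [] = refl
filterᵇ-map P f (x ∷ xs) with P (f x)
... | true  = cong (f x ∷_) (filterᵇ-map P f xs)
... | false = filterᵇ-map P f xs

length-filterᵇ-false : ∀ (xs : List A) → length (filterᵇ (λ _ → false) xs) ≡ 0
length-filterᵇ-false [] = refl
length-filterᵇ-false (x ∷ xs) = length-filterᵇ-false xs

foldr-⊔-≤ : ∀ (f : A → ℕ) {n} xs → (∀ {x} → x ∈ xs → f x ≤ n) →
  foldr (λ x m → f x ⊔ m) 0 xs ≤ n
foldr-⊔-≤ f [] bound = z≤n
foldr-⊔-≤ f (x ∷ xs) bound = ⊔-lub (bound (here refl)) (foldr-⊔-≤ f xs (bound ∘ there))

≤-foldr-⊔ : ∀ (f : A → ℕ) {x xs} → x ∈ xs → f x ≤ foldr (λ y m → f y ⊔ m) 0 xs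
≤-foldr-⊔ f {xs = y ∷ xs} (here refl) = m≤m⊔n (f y) _
≤-foldr-⊔ f {xs = y ∷ xs} (there x∈) = ≤-trans (≤-foldr-⊔ f x∈) (m≤n⊔m (f y) _)

-- The cube: words of length n and Hamming spheres

words-length : ∀ n {w} → w ∈ words n → length w ≡ n
words-length zero (here refl) = refl
words-length (suc n) w∈ with ∈-++⁻ (map (false ∷_) (words n)) w∈
... | inj₁ w∈₀ with _ , w′∈ , refl ← ∈-map⁻ (false ∷_) w∈₀ = cong suc (words-length n w′∈)
... | inj₂ w∈₁ with _ , w′∈ , refl ← ∈-map⁻ (true ∷_) w∈₁ = cong suc (words-length n w′∈)

∈-words : ∀ {n} w → length w ≡ n → w ∈ words n
∈-words [] refl = here refl
∈-words (false ∷ w) refl = ∈-++⁺ˡ (∈-map⁺ (false ∷_) (∈-words w refl))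
∈-words (true ∷ w) refl =
  ∈-++⁺ʳ (map (false ∷_) (words (length w))) (∈-map⁺ (true ∷_) (∈-words w refl))

length-filterᵇ-words-suc : ∀ (P : Word → Bool) n →
  length (filterᵇ P (words (suc n)))
    ≡ length (filterᵇ (P ∘ (false ∷_)) (words n)) + length (filterᵇ (P ∘ (true ∷_)) (words n))
length-filterᵇ-words-suc P n = begin
  length (filterᵇ P (map (false ∷_) W ++ map (true ∷_) W))
    ≡⟨ cong length (filter-++ (T? ∘ P) (map (false ∷_) W) _) ⟩
  length (filterᵇ P (map (false ∷_) W) ++ filterᵇ P (map (true ∷_) W))
    ≡⟨ length-++ (filterᵇ P (map (false ∷_) W)) ⟩
  length (filterᵇ P (map (false ∷_) W)) + length (filterᵇ P (map (true ∷_) W))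
    ≡⟨ cong₂ _+_ (length-filterᵇ-map (false ∷_)) (length-filterᵇ-map (true ∷_)) ⟩
  length (filterᵇ (P ∘ (false ∷_)) W) + length (filterᵇ (P ∘ (true ∷_)) W) ∎
  where
    open ≡-Reasoning
    W : List Word
    W = words n
    length-filterᵇ-map : ∀ f → length (filterᵇ P (map f W)) ≡ length (filterᵇ (P ∘ f) W)
    length-filterᵇ-map f = trans (cong length (filterᵇ-map P f W)) (length-map f (filterᵇ (P ∘ f) W))

sphere : Word → ℕ → List Word
sphere v d = filterᵇ (λ w → ham v w ≡ᵇ d) (words (length v))

-- Pascal's rule: words agreeing with v in the first letter stay at distance d, the others move to d - 1.
length-sphere : ∀ v d → length (sphere v d) ≡ length v C d
length-sphere [] zero = refl
length-sphere [] (suc d) = refl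
length-sphere (false ∷ v) zero = trans (length-filterᵇ-words-suc _ (length v))
  (cong₂ _+_ (length-sphere v 0) (length-filterᵇ-false (words (length v))))
length-sphere (true ∷ v) zero = trans (length-filterᵇ-words-suc _ (length v))
  (cong₂ _+_ (length-filterᵇ-false (words (length v))) (length-sphere v 0))
length-sphere (false ∷ v) (suc d) = begin
  length (sphere (false ∷ v) (suc d))              ≡⟨ length-filterᵇ-words-suc _ (length v) ⟩
  length (sphere v (suc d)) + length (sphere v d)  ≡⟨ cong₂ _+_ (length-sphere v (suc d)) (length-sphere v d) ⟩
  length v C suc d + length v C d                  ≡⟨ +-comm (length v C suc d) _ ⟩
  length v C d + length v C suc d                  ≡⟨ nCk+nC[k+1]≡[n+1]C[k+1] (length v) d ⟩
  suc (length v) C suc d                           ∎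
  where open ≡-Reasoning
length-sphere (true ∷ v) (suc d) = begin
  length (sphere (true ∷ v) (suc d))               ≡⟨ length-filterᵇ-words-suc _ (length v) ⟩
  length (sphere v d) + length (sphere v (suc d))  ≡⟨ cong₂ _+_ (length-sphere v d) (length-sphere v (suc d)) ⟩
  length v C d + length v C suc d                  ≡⟨ nCk+nC[k+1]≡[n+1]C[k+1] (length v) d ⟩
  suc (length v) C suc d                           ∎
  where open ≡-Reasoning

neighbours : Word → List Word
neighbours v = sphere v 1

length-neighbours : ∀ v → length (neighbours v) ≡ length v
length-neighbours v = trans (length-sphere v 1) (nC1≡n (length v))

∈-neighbours⁺ : ∀ v {w} → length w ≡ length v → ham v w ≡ 1 → w ∈ neighbours v
∈-neighbours⁺ v {w} lw h =
  ∈-filter⁺ (T? ∘ λ u → ham v u ≡ᵇ 1) (∈-words w lw) (≡⇒≡ᵇ (ham v w) 1 h)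

∈-neighbours⁻ : ∀ v {w} → w ∈ neighbours v → length w ≡ length v × ham v w ≡ 1
∈-neighbours⁻ v {w} w∈ with w∈words , adjacent ← ∈-filter⁻ (T? ∘ λ u → ham v u ≡ᵇ 1) w∈ =
  words-length (length v) w∈words , ≡ᵇ⇒≡ (ham v w) 1 adjacent

-- Degrees in induced subgraphs of the cube

induced : (Word → Bool) → ℕ → List Word
induced P n = filterᵇ P (words n)

∈-induced⁺ : ∀ {P n w} → length w ≡ n → P w ≡ true → w ∈ induced P n
∈-induced⁺ {P} {w = w} lw Pw = ∈-filter⁺ (T? ∘ P) (∈-words w lw) (≡true⇒T Pw)

∈-induced⁻ : ∀ {P n w} → w ∈ induced P n → length w ≡ n × P w ≡ true
∈-induced⁻ {P} {n} w∈ with w∈words , Pw ← ∈-filter⁻ (T? ∘ P) w∈ =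
  words-length n w∈words , Equivalence.to T-≡ Pw

HasOutsideNeighbour : (Word → Bool) → Word → Set
HasOutsideNeighbour P v = ∃[ w ] length w ≡ length v × ham v w ≡ 1 × P w ≡ false

deg-induced : ∀ P v → deg (induced P (length v)) v ≡ length (filterᵇ P (neighbours v))
deg-induced P v = cong length (filterᵇ-comm (λ w → ham v w ≡ᵇ 1) P (words (length v)))

deg-induced-≤ : ∀ P v {n} → length v ≡ n → deg (induced P n) v ≤ n
deg-induced-≤ P v refl = begin
  deg (induced P (length v)) v           ≡⟨ deg-induced P v ⟩
  length (filterᵇ P (neighbours v))      ≤⟨ length-filter (T? ∘ P) (neighbours v) ⟩
  length (neighbours v)                  ≡⟨ length-neighbours v ⟩
  length v                               ∎
  where open ≤-Reasoning

deg-induced-≡ : ∀ P v {n} → length v ≡ n → All (λ w → P w ≡ true) (neighbours v) →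
  deg (induced P n) v ≡ n
deg-induced-≡ P v refl inside = begin
  deg (induced P (length v)) v           ≡⟨ deg-induced P v ⟩
  length (filterᵇ P (neighbours v))      ≡⟨ cong length (filter-all (T? ∘ P) (All.map ≡true⇒T inside)) ⟩
  length (neighbours v)                  ≡⟨ length-neighbours v ⟩
  length v                               ∎
  where open ≡-Reasoning

deg-induced-< : ∀ P v {n} → length v ≡ n → HasOutsideNeighbour P v → deg (induced P n) v < n
deg-induced-< P v refl (w , lw , h , Pw) = begin-strict
  deg (induced P (length v)) v           ≡⟨ deg-induced P v ⟩
  length (filterᵇ P (neighbours v))      <⟨ filter-notAll (T? ∘ P) (neighbours v) outside ⟩
  length (neighbours v)                  ≡⟨ length-neighbours v ⟩
  length v                               ∎
  where
    open ≤-Reasoning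
    outside : Any (λ u → ¬ T (P u)) (neighbours v)
    outside = lose (∈-neighbours⁺ v lw h) (≡false⇒¬T Pw)

weight : Word → ℕ
weight [] = 0
weight (true ∷ w) = suc (weight w)
weight (false ∷ w) = weight w

weight-replicate-false : ∀ k → weight (replicate k false) ≡ 0
weight-replicate-false zero = refl
weight-replicate-false (suc k) = weight-replicate-false k

weight-replicate-true : ∀ k → weight (replicate k true) ≡ k
weight-replicate-true zero = refl
weight-replicate-true (suc k) = cong suc (weight-replicate-true k)

weight-++-true : ∀ xs ys → 1 ≤ weight (xs ++ true ∷ ys)
weight-++-true [] ys = s≤s z≤n
weight-++-true (true ∷ xs) ys = m≤n⇒m≤1+n (weight-++-true xs ys)
weight-++-true (false ∷ xs) ys = weight-++-true xs ys

weight-ham : ∀ v w → length v ≡ length w → weight w ≤ weight v + ham v w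
weight-ham [] [] _ = z≤n
weight-ham (true ∷ v) (true ∷ w) e = s≤s (weight-ham v w (suc-injective e))
weight-ham (false ∷ v) (false ∷ w) e = weight-ham v w (suc-injective e)
weight-ham (true ∷ v) (false ∷ w) e =
  m≤n⇒m≤1+n (≤-trans (weight-ham v w (suc-injective e)) (+-monoʳ-≤ (weight v) (n≤1+n (ham v w))))
weight-ham (false ∷ v) (true ∷ w) e =
  ≤-trans (s≤s (weight-ham v w (suc-injective e))) (≤-reflexive (sym (+-suc (weight v) (ham v w))))

weight-neighbour : ∀ v {w} → w ∈ neighbours v → weight w ≤ weight v + 1
weight-neighbour v {w} w∈ with lw , h ← ∈-neighbours⁻ v w∈ =
  subst (λ d → weight w ≤ weight v + d) h (weight-ham v w (sym lw))

AcceptsLightWords : (Word → Bool) → Set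
AcceptsLightWords P = ∀ w → weight w ≤ 1 → P w ≡ true

deg-zeroWord : ∀ P n → AcceptsLightWords P → deg (induced P n) (zeroWord n) ≡ n
deg-zeroWord P n light = deg-induced-≡ P (zeroWord n) (length-replicate n) (All.tabulate neighbour-light)
  where
    neighbour-light : ∀ {w} → w ∈ neighbours (zeroWord n) → P w ≡ true
    neighbour-light w∈ = light _
      (≤-trans (weight-neighbour (zeroWord n) w∈) (≤-reflexive (cong (_+ 1) (weight-replicate-false n))))

Δ-induced : ∀ P n → AcceptsLightWords P → Δ (induced P n) ≡ n
Δ-induced P n light = ≤-antisym
  (foldr-⊔-≤ (deg V) V (λ {v} v∈ → deg-induced-≤ P v (proj₁ (∈-induced⁻ v∈))))
  (subst (_≤ Δ V) (deg-zeroWord P n light) (≤-foldr-⊔ (deg V) zero∈V))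
  where
    V : List Word
    V = induced P n
    zero∈V : zeroWord n ∈ V
    zero∈V = ∈-induced⁺ (length-replicate n) (light _ (subst (_≤ 1) (sym (weight-replicate-false n)) z≤n))

-- When 0^n is the only vertex of maximum degree

OnlyZeroMaximal : (Word → Bool) → ℕ → Set
OnlyZeroMaximal P n = ∀ v → v ∈ induced P n → deg (induced P n) v ≡ Δ (induced P n) → v ≡ zeroWord n

zeroWord-or-firstOne : ∀ v → v ≡ zeroWord (length v) ⊎ ∃[ k ] ∃[ R ] v ≡ replicate k false ++ true ∷ R
zeroWord-or-firstOne [] = inj₁ refl
zeroWord-or-firstOne (true ∷ v) = inj₂ (0 , v , refl)
zeroWord-or-firstOne (false ∷ v) with zeroWord-or-firstOne v
... | inj₁ v≡0 = inj₁ (cong (false ∷_) v≡0)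
... | inj₂ (k , R , v≡) = inj₂ (suc k , R , cong (false ∷_) v≡)

NonzeroHaveOutsideNeighbours : (Word → Bool) → ℕ → Set
NonzeroHaveOutsideNeighbours P m = ∀ k R →
  m ≤ length (replicate k false ++ true ∷ R) → P (replicate k false ++ true ∷ R) ≡ true →
  HasOutsideNeighbour P (replicate k false ++ true ∷ R)

onlyZeroMaximal-intro : ∀ {P m n} → AcceptsLightWords P → m ≤ n → NonzeroHaveOutsideNeighbours P m → OnlyZeroMaximal P n
onlyZeroMaximal-intro {P} {n = n} light m≤n escape v v∈ maximal with ∈-induced⁻ {P} {n} v∈
... | refl , Pv with zeroWord-or-firstOne v
...   | inj₁ v≡0 = v≡0
...   | inj₂ (k , R , refl) = contradiction (trans maximal (Δ-induced P _ light))
                                (<⇒≢ (deg-induced-< P (replicate k false ++ true ∷ R) refl (escape k R m≤n Pv)))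

onlyZeroMaximal-counterexample : ∀ {P n} v → AcceptsLightWords P → length v ≡ n → P v ≡ true → v ≢ zeroWord n →
  All (λ w → P w ≡ true) (neighbours v) → ¬ OnlyZeroMaximal P n
onlyZeroMaximal-counterexample {P} {n} v light lv Pv v≢0 inside only =
  v≢0 (only v (∈-induced⁺ lv Pv) (trans (deg-induced-≡ P v lv inside) (sym (Δ-induced P n light))))

¬onlyZeroMaximal-weight≤2 : ∀ P m → (∀ w → weight w ≤ 2 → P w ≡ true) → ¬ OnlyZeroMaximal P (suc m)
¬onlyZeroMaximal-weight≤2 P m heavy = onlyZeroMaximal-counterexample v
  (λ w w≤1 → heavy w (m≤n⇒m≤1+n w≤1)) (cong suc (length-replicate m)) (heavy v weight-v≤2) (λ ())
  (All.tabulate (λ w∈ → heavy _ (≤-trans (weight-neighbour v w∈) (+-monoˡ-≤ 1 weight-v≤1))))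
  where
    v : Word
    v = true ∷ replicate m false
    weight-v≤1 : weight v ≤ 1
    weight-v≤1 = s≤s (≤-reflexive (weight-replicate-false m))
    weight-v≤2 : weight v ≤ 2
    weight-v≤2 = m≤n⇒m≤1+n weight-v≤1

isPrefix-weight : ∀ u w → weight w < weight u → isPrefix u w ≡ false
isPrefix-weight [] w ()
isPrefix-weight (_ ∷ _) [] _ = refl
isPrefix-weight (true ∷ u) (true ∷ w) (s≤s lt) = isPrefix-weight u w lt
isPrefix-weight (false ∷ u) (false ∷ w) lt = isPrefix-weight u w lt
isPrefix-weight (true ∷ u) (false ∷ w) _ = refl
isPrefix-weight (false ∷ u) (true ∷ w) _ = refl

isFactor-weight : ∀ u w → weight w < weight u → isFactor u w ≡ false
isFactor-weight u [] lt = isPrefix-weight u [] lt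
isFactor-weight u (y ∷ w) lt =
  cong₂ _∨_ (isPrefix-weight u (y ∷ w) lt) (isFactor-weight u w (≤-<-trans (weight-∷ y w) lt))
  where
    weight-∷ : ∀ y w → weight w ≤ weight (y ∷ w)
    weight-∷ true w = n≤1+n (weight w)
    weight-∷ false w = ≤-refl

isPrefix-++ : ∀ u ys → isPrefix u (u ++ ys) ≡ true
isPrefix-++ [] ys = refl
isPrefix-++ (true ∷ u) ys = isPrefix-++ u ys
isPrefix-++ (false ∷ u) ys = isPrefix-++ u ys

isFactor-++ˡ : ∀ u zs {w} → isFactor u w ≡ true → isFactor u (zs ++ w) ≡ true
isFactor-++ˡ u [] h = h
isFactor-++ˡ u (z ∷ zs) {w} h = trans (cong (isPrefix u (z ∷ zs ++ w) ∨_) (isFactor-++ˡ u zs h)) (∨-zeroʳ _)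

isFactor-infix : ∀ u zs ys → isFactor u (zs ++ u ++ ys) ≡ true
isFactor-infix u zs ys = isFactor-++ˡ u zs (isPrefix⇒isFactor (u ++ ys) (isPrefix-++ u ys))
  where
    isPrefix⇒isFactor : ∀ w → isPrefix u w ≡ true → isFactor u w ≡ true
    isPrefix⇒isFactor [] h = h
    isPrefix⇒isFactor (_ ∷ _) h = cong (_∨ _) h

Forbids : (Word → Bool) → Word → Set
Forbids P u = ∀ w → isFactor u w ≡ true → P w ≡ false

forbidden : ∀ {P u w} {C : Set} → Forbids P u → isFactor u w ≡ true → P w ≡ true → C
forbidden {w = w} forbid u∈w Pw = contradiction (trans (sym Pw) (forbid w u∈w)) λ ()

ham-refl : ∀ w → ham w w ≡ 0
ham-refl [] = refl
ham-refl (true ∷ w) = ham-refl w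
ham-refl (false ∷ w) = ham-refl w

ham-++ : ∀ zs s t → ham (zs ++ s) (zs ++ t) ≡ ham s t
ham-++ [] s t = refl
ham-++ (true ∷ zs) s t = ham-++ zs s t
ham-++ (false ∷ zs) s t = ham-++ zs s t

outsideNeighbour : ∀ {P} zs {s t} → length t ≡ length s → ham s t ≡ 1 → P (zs ++ t) ≡ false →
  HasOutsideNeighbour P (zs ++ s)
outsideNeighbour zs {s} {t} lt h Pt = zs ++ t , length-++-≡ , trans (ham-++ zs s t) h , Pt
  where
    length-++-≡ : length (zs ++ t) ≡ length (zs ++ s)
    length-++-≡ = trans (length-++ zs) (trans (cong (length zs +_) lt) (sym (length-++ zs)))

replicate-suc-++ : ∀ k (x : A) ys → replicate (suc k) x ++ ys ≡ replicate k x ++ x ∷ ys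
replicate-suc-++ zero x ys = refl
replicate-suc-++ (suc k) x ys = cong (x ∷_) (replicate-suc-++ k x ys)

nonzero-outside-11 : ∀ {P} → Forbids P (true ∷ true ∷ []) → NonzeroHaveOutsideNeighbours P 2
nonzero-outside-11 forbid k (true ∷ R) _ Pv = forbidden forbid (isFactor-infix _ (replicate k false) R) Pv
nonzero-outside-11 forbid k (false ∷ R) _ _ =
  outsideNeighbour (replicate k false) {true ∷ false ∷ R} {true ∷ true ∷ R} refl (cong suc (ham-refl R))
    (forbid _ (isFactor-infix _ (replicate k false) R))
nonzero-outside-11 {P} forbid (suc k) [] _ _ =
  subst (HasOutsideNeighbour P) (sym (replicate-suc-++ k false (true ∷ [])))
    (outsideNeighbour (replicate k false) {false ∷ true ∷ []} {true ∷ true ∷ []} refl refl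
      (forbid _ (isFactor-infix _ (replicate k false) [])))
nonzero-outside-11 forbid zero [] (s≤s ()) _

-- Every nonzero word of length ≥ 4 except 0110 contains 101 or has a flip containing 101; for 0110
-- the neighbour 0111 is needed, so it must be excluded by length (m > 0) or rejected by P.
nonzero-outside-101 : ∀ {P} m → Forbids P (true ∷ false ∷ true ∷ []) →
  0 < m ⊎ P (false ∷ true ∷ true ∷ true ∷ []) ≡ false → NonzeroHaveOutsideNeighbours P (4 + m)
nonzero-outside-101 {P} _ forbid _ (suc (suc k)) R _ _ =
  subst (HasOutsideNeighbour P) (sym (trans (replicate-suc-++ (suc k) false _) (replicate-suc-++ k false _)))
    (outsideNeighbour (replicate k false) {false ∷ false ∷ true ∷ R} {true ∷ false ∷ true ∷ R} refl
      (cong suc (ham-refl R))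
      (forbid _ (isFactor-infix _ (replicate k false) R)))
nonzero-outside-101 _ forbid _ k (false ∷ false ∷ R) _ _ =
  outsideNeighbour (replicate k false) {true ∷ false ∷ false ∷ R} {true ∷ false ∷ true ∷ R} refl
    (cong suc (ham-refl R))
    (forbid _ (isFactor-infix _ (replicate k false) R))
nonzero-outside-101 _ forbid _ k (false ∷ true ∷ R) _ Pv =
  forbidden forbid (isFactor-infix _ (replicate k false) R) Pv
nonzero-outside-101 _ forbid _ k (true ∷ true ∷ R) _ _ =
  outsideNeighbour (replicate k false) {true ∷ true ∷ true ∷ R} {true ∷ false ∷ true ∷ R} refl
    (cong suc (ham-refl R))
    (forbid _ (isFactor-infix _ (replicate k false) R))
nonzero-outside-101 _ forbid _ k (true ∷ false ∷ false ∷ R) _ _ =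
  outsideNeighbour (replicate k false) {true ∷ true ∷ false ∷ false ∷ R} {true ∷ true ∷ false ∷ true ∷ R} refl
    (cong suc (ham-refl R))
    (forbid _ (isFactor-++ˡ _ (replicate k false) (isFactor-infix (true ∷ false ∷ true ∷ []) (true ∷ []) R)))
nonzero-outside-101 _ forbid _ k (true ∷ false ∷ true ∷ R) _ Pv =
  forbidden forbid
    (isFactor-++ˡ _ (replicate k false) (isFactor-infix (true ∷ false ∷ true ∷ []) (true ∷ []) R)) Pv
nonzero-outside-101 _ _ (inj₂ P0111≡false) (suc zero) (true ∷ false ∷ []) _ _ =
  outsideNeighbour [] {false ∷ true ∷ true ∷ false ∷ []} {false ∷ true ∷ true ∷ true ∷ []} refl refl
    P0111≡false
nonzero-outside-101 (suc _) _ (inj₁ _) (suc zero) (true ∷ false ∷ []) (s≤s (s≤s (s≤s (s≤s ())))) _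
nonzero-outside-101 zero _ (inj₁ ()) (suc zero) (true ∷ false ∷ []) _ _
nonzero-outside-101 _ _ _ zero (true ∷ false ∷ []) (s≤s (s≤s (s≤s ()))) _
nonzero-outside-101 _ _ _ zero (true ∷ []) (s≤s (s≤s ())) _
nonzero-outside-101 _ _ _ (suc zero) (true ∷ []) (s≤s (s≤s (s≤s ()))) _
nonzero-outside-101 _ _ _ zero (false ∷ []) (s≤s (s≤s ())) _
nonzero-outside-101 _ _ _ (suc zero) (false ∷ []) (s≤s (s≤s (s≤s ()))) _
nonzero-outside-101 _ _ _ zero [] (s≤s ()) _
nonzero-outside-101 _ _ _ (suc zero) [] (s≤s (s≤s ())) _

all-true : ∀ (f : ℕ → Bool) js → (∀ j → f j ≡ true) → all f js ≡ true
all-true f [] _ = refl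
all-true f (j ∷ js) fj rewrite fj j = all-true f js fj

2≤weight-oneZerosOne : ∀ j → 2 ≤ weight (oneZerosOne j)
2≤weight-oneZerosOne j = s≤s (weight-++-true (replicate j false) [])

isFactor-oneZerosOne-light : ∀ j w → weight w ≤ 1 → isFactor (oneZerosOne j) w ≡ false
isFactor-oneZerosOne-light j w w≤1 = isFactor-weight _ w (≤-trans (s≤s w≤1) (2≤weight-oneZerosOne j))

isFactor-ones : ∀ r w → weight w ≤ r → isFactor (replicate (suc r) true) w ≡ false
isFactor-ones r w w≤r =
  isFactor-weight _ w (subst (weight w <_) (sym (weight-replicate-true (suc r))) (s≤s w≤r))

isOWord-light : ∀ p r → 1 ≤ r → AcceptsLightWords (isOWord p r)
isOWord-light p (suc r) _ w w≤1 = cong₂ (λ a b → a ∧ not b)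
  (all-true _ (upTo (p ∸ 1)) (λ j → cong not (isFactor-oneZerosOne-light j w w≤1)))
  (isFactor-weight _ w (≤-trans (s≤s w≤1)
    (s≤s (weight-++-true (replicate (p ∸ 1) false ++ concat (replicate r (true ∷ replicate (p ∸ 1) false))) []))))

isOWord-weight≤2 : ∀ r → 2 ≤ r → ∀ w → weight w ≤ 2 → isOWord 1 r w ≡ true
isOWord-weight≤2 r r≥2 w w≤2 = cong (λ b → true ∧ not b)
  (isFactor-weight _ w (subst (weight w <_) (sym (weight-run r)) (s≤s (≤-trans w≤2 r≥2))))
  where
    weight-run : ∀ r → weight (concat (replicate r (true ∷ [])) ++ true ∷ []) ≡ suc r
    weight-run zero = refl
    weight-run (suc r) = cong suc (weight-run r)

isOWord-forbids-11 : ∀ p r → r ≡ 1 ⊎ 2 ≤ p → Forbids (isOWord p r) (true ∷ true ∷ [])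
isOWord-forbids-11 (suc (suc p)) r _ w 11∈w rewrite 11∈w = refl
isOWord-forbids-11 (suc zero) .1 (inj₁ refl) w 11∈w rewrite 11∈w = refl
isOWord-forbids-11 zero .1 (inj₁ refl) w 11∈w rewrite 11∈w = refl
isOWord-forbids-11 (suc zero) r (inj₂ (s≤s ()))
isOWord-forbids-11 zero r (inj₂ ())

isIWord-light : ∀ p r → 1 ≤ r → AcceptsLightWords (isIWord p r)
isIWord-light p r r≥1 w w≤1 = cong₂ (λ a b → not a ∧ b)
  (isFactor-ones r w (≤-trans w≤1 r≥1))
  (all-true _ (upTo (p ∸ 1)) (λ j → cong not (isFactor-oneZerosOne-light (suc j) w w≤1)))

isIWord-weight≤2 : ∀ r → 2 ≤ r → ∀ w → weight w ≤ 2 → isIWord 1 r w ≡ true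
isIWord-weight≤2 r r≥2 w w≤2 = cong (λ a → not a ∧ true) (isFactor-ones r w (≤-trans w≤2 r≥2))

block : ℕ → ℕ → ℕ → Word
block a b c = replicate a false ++ replicate b true ++ replicate c false

weight-block : ∀ a b c → weight (block a b c) ≡ b
weight-block (suc a) b c = weight-block a b c
weight-block zero (suc b) c = cong suc (weight-block zero b c)
weight-block zero zero c = weight-replicate-false c

isPrefix-zeros : ∀ u c → 1 ≤ weight u → isPrefix u (replicate c false) ≡ false
isPrefix-zeros u c 1≤u = isPrefix-weight u (replicate c false) (subst (_< weight u) (sym (weight-replicate-false c)) 1≤u)

isFactor-zeros : ∀ u c → 1 ≤ weight u → isFactor u (replicate c false) ≡ false
isFactor-zeros u c 1≤u = isFactor-weight u (replicate c false) (subst (_< weight u) (sym (weight-replicate-false c)) 1≤u)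

isFactor-oneZerosOne-block : ∀ j a b c → isFactor (oneZerosOne (suc j)) (block a b c) ≡ false
isFactor-oneZerosOne-block j (suc a) b c = isFactor-oneZerosOne-block j a b c
isFactor-oneZerosOne-block j zero (suc (suc b)) c = isFactor-oneZerosOne-block j zero (suc b) c
isFactor-oneZerosOne-block j zero (suc zero) c = cong₂ _∨_
  (isPrefix-zeros (replicate (suc j) false ++ true ∷ []) c (weight-++-true (replicate (suc j) false) []))
  (isFactor-zeros (oneZerosOne (suc j)) c (≤-trans (s≤s z≤n) (2≤weight-oneZerosOne (suc j))))
isFactor-oneZerosOne-block j zero zero c =
  isFactor-zeros (oneZerosOne (suc j)) c (≤-trans (s≤s z≤n) (2≤weight-oneZerosOne (suc j)))

isIWord-block : ∀ p r a b c → b ≤ r → isIWord p r (block a b c) ≡ true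
isIWord-block p r a b c b≤r = cong₂ (λ x y → not x ∧ y)
  (isFactor-ones r (block a b c) (subst (_≤ r) (sym (weight-block a b c)) b≤r))
  (all-true _ (upTo (p ∸ 1)) (λ j → cong not (isFactor-oneZerosOne-block j a b c)))

isIWord-forbids-11 : ∀ p → Forbids (isIWord p 1) (true ∷ true ∷ [])
isIWord-forbids-11 p w 11∈w rewrite 11∈w = refl

isIWord-forbids-111 : ∀ p → Forbids (isIWord p 2) (true ∷ true ∷ true ∷ [])
isIWord-forbids-111 p w 111∈w rewrite 111∈w = refl

isIWord-forbids-101 : ∀ p r → 2 ≤ p → Forbids (isIWord p r) (true ∷ false ∷ true ∷ [])
isIWord-forbids-101 (suc (suc p)) r _ w 101∈w rewrite 101∈w = ∧-zeroʳ _
isIWord-forbids-101 (suc zero) r (s≤s ())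

isIWord-¬onlyZeroMaximal-2 : ∀ p r → 2 ≤ r → ¬ OnlyZeroMaximal (isIWord p r) 2
isIWord-¬onlyZeroMaximal-2 p r r≥2 =
  onlyZeroMaximal-counterexample (block 0 1 1) (isIWord-light p r r≥1) refl (isIWord-block p r 0 1 1 r≥1) (λ ())
    (isIWord-block p r 0 0 2 z≤n ∷ isIWord-block p r 0 2 0 r≥2 ∷ [])
  where
    r≥1 : 1 ≤ r
    r≥1 = ≤-trans (s≤s z≤n) r≥2

isIWord-¬onlyZeroMaximal-3 : ∀ p r → 2 ≤ r → ¬ OnlyZeroMaximal (isIWord p r) 3
isIWord-¬onlyZeroMaximal-3 p r r≥2 =
  onlyZeroMaximal-counterexample (block 1 1 1) (isIWord-light p r r≥1) refl (isIWord-block p r 1 1 1 r≥1) (λ ())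
    (isIWord-block p r 0 0 3 z≤n ∷ isIWord-block p r 1 2 0 r≥2 ∷ isIWord-block p r 0 2 1 r≥2 ∷ [])
  where
    r≥1 : 1 ≤ r
    r≥1 = ≤-trans (s≤s z≤n) r≥2

isIWord-¬onlyZeroMaximal-4 : ∀ p r → 3 ≤ r → ¬ OnlyZeroMaximal (isIWord p r) 4
isIWord-¬onlyZeroMaximal-4 p r r≥3 =
  onlyZeroMaximal-counterexample (block 1 2 1) (isIWord-light p r r≥1) refl (isIWord-block p r 1 2 1 r≥2) (λ ())
    (isIWord-block p r 2 1 1 r≥1 ∷ isIWord-block p r 1 1 2 r≥1 ∷ isIWord-block p r 1 3 0 r≥3 ∷
     isIWord-block p r 0 3 1 r≥3 ∷ [])
  where
    r≥2 : 2 ≤ r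
    r≥2 = ≤-trans (s≤s (s≤s z≤n)) r≥3
    r≥1 : 1 ≤ r
    r≥1 = ≤-trans (s≤s z≤n) r≥2

OV-onlyZeroMaximal⇔ : ∀ n p r → 1 ≤ p → 1 ≤ r → 2 ≤ n →
  OnlyZeroMaximal (isOWord p r) n ⇔ ((1 ≤ p × r ≡ 1 × 2 ≤ n) ⊎ (2 ≤ p × 2 ≤ r × 2 ≤ n))
OV-onlyZeroMaximal⇔ n p r p≥1 r≥1 n≥2 = mk⇔ (to n p r p≥1 r≥1 n≥2) from
  where
    to : ∀ n p r → 1 ≤ p → 1 ≤ r → 2 ≤ n → OnlyZeroMaximal (isOWord p r) n →
      (1 ≤ p × r ≡ 1 × 2 ≤ n) ⊎ (2 ≤ p × 2 ≤ r × 2 ≤ n)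
    to n p 1 p≥1 _ n≥2 _ = inj₁ (p≥1 , refl , n≥2)
    to n (suc (suc p)) (suc (suc r)) _ _ n≥2 _ = inj₂ (m≤m+n 2 p , m≤m+n 2 r , n≥2)
    to (suc n) 1 (suc (suc r)) _ _ _ only =
      contradiction only (¬onlyZeroMaximal-weight≤2 _ n (isOWord-weight≤2 (2 + r) (m≤m+n 2 r)))
    to zero _ _ _ _ () _
    to _ zero _ () _ _ _
    to _ (suc _) zero _ () _ _

    from : (1 ≤ p × r ≡ 1 × 2 ≤ n) ⊎ (2 ≤ p × 2 ≤ r × 2 ≤ n) → OnlyZeroMaximal (isOWord p r) n
    from c = onlyZeroMaximal-intro (isOWord-light p r r≥1) n≥2
      (nonzero-outside-11 (isOWord-forbids-11 p r (Sum.map (λ (_ , r≡1 , _) → r≡1) proj₁ c)))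

IV-onlyZeroMaximal⇔ : ∀ n p r → 1 ≤ p → 1 ≤ r → 2 ≤ n →
  OnlyZeroMaximal (isIWord p r) n
    ⇔ ((1 ≤ p × r ≡ 1 × 2 ≤ n) ⊎ (2 ≤ p × r ≡ 2 × 4 ≤ n) ⊎ (2 ≤ p × 3 ≤ r × 5 ≤ n))
IV-onlyZeroMaximal⇔ n p r p≥1 r≥1 n≥2 = mk⇔ (to n p r p≥1 r≥1 n≥2) from
  where
    to : ∀ n p r → 1 ≤ p → 1 ≤ r → 2 ≤ n → OnlyZeroMaximal (isIWord p r) n →
      (1 ≤ p × r ≡ 1 × 2 ≤ n) ⊎ (2 ≤ p × r ≡ 2 × 4 ≤ n) ⊎ (2 ≤ p × 3 ≤ r × 5 ≤ n)
    to n p 1 p≥1 _ n≥2 _ = inj₁ (p≥1 , refl , n≥2)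
    to (suc n) 1 (suc (suc r)) _ _ _ only =
      contradiction only (¬onlyZeroMaximal-weight≤2 _ n (isIWord-weight≤2 (2 + r) (m≤m+n 2 r)))
    to 2 (suc (suc p)) (suc (suc r)) _ _ _ only =
      contradiction only (isIWord-¬onlyZeroMaximal-2 (2 + p) (2 + r) (m≤m+n 2 r))
    to 3 (suc (suc p)) (suc (suc r)) _ _ _ only =
      contradiction only (isIWord-¬onlyZeroMaximal-3 (2 + p) (2 + r) (m≤m+n 2 r))
    to (suc (suc (suc (suc n)))) (suc (suc p)) 2 _ _ _ _ = inj₂ (inj₁ (m≤m+n 2 p , refl , m≤m+n 4 n))
    to 4 (suc (suc p)) (suc (suc (suc r))) _ _ _ only =
      contradiction only (isIWord-¬onlyZeroMaximal-4 (2 + p) (3 + r) (m≤m+n 3 r))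
    to (suc (suc (suc (suc (suc n))))) (suc (suc p)) (suc (suc (suc r))) _ _ _ _ =
      inj₂ (inj₂ (m≤m+n 2 p , m≤m+n 3 r , m≤m+n 5 n))
    to zero _ _ _ _ () _
    to 1 _ _ _ _ (s≤s ()) _
    to _ zero _ () _ _ _
    to _ (suc _) zero _ () _ _

    from : (1 ≤ p × r ≡ 1 × 2 ≤ n) ⊎ (2 ≤ p × r ≡ 2 × 4 ≤ n) ⊎ (2 ≤ p × 3 ≤ r × 5 ≤ n) →
      OnlyZeroMaximal (isIWord p r) n
    from (inj₁ (_ , refl , _)) =
      onlyZeroMaximal-intro (isIWord-light p r r≥1) n≥2 (nonzero-outside-11 (isIWord-forbids-11 p))
    from (inj₂ (inj₁ (p≥2 , refl , n≥4))) =
      onlyZeroMaximal-intro (isIWord-light p r r≥1) n≥4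
        (nonzero-outside-101 0 (isIWord-forbids-101 p r p≥2)
          (inj₂ (isIWord-forbids-111 p (false ∷ true ∷ true ∷ true ∷ [])
            (isFactor-infix (true ∷ true ∷ true ∷ []) (false ∷ []) []))))
    from (inj₂ (inj₂ (p≥2 , _ , n≥5))) =
      onlyZeroMaximal-intro (isIWord-light p r r≥1) n≥5
        (nonzero-outside-101 1 (isIWord-forbids-101 p r p≥2) (inj₁ (s≤s z≤n)))

theorem5p1 : (n p r : ℕ) → 1 ≤ p → 1 ≤ r → 2 ≤ n →
    (Δ (OV n p r) ≡ n) × (Δ (IV n p r) ≡ n)
    × (deg (OV n p r) (zeroWord n) ≡ n) × (deg (IV n p r) (zeroWord n) ≡ n)
    × ((∀ v → v ∈ OV n p r → deg (OV n p r) v ≡ Δ (OV n p r) → v ≡ zeroWord n)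
        ⇔ ((1 ≤ p × r ≡ 1 × 2 ≤ n) ⊎ (2 ≤ p × 2 ≤ r × 2 ≤ n)))
    × ((∀ v → v ∈ IV n p r → deg (IV n p r) v ≡ Δ (IV n p r) → v ≡ zeroWord n)
        ⇔ ((1 ≤ p × r ≡ 1 × 2 ≤ n) ⊎ (2 ≤ p × r ≡ 2 × 4 ≤ n) ⊎ (2 ≤ p × 3 ≤ r × 5 ≤ n)))
theorem5p1 n p r p≥1 r≥1 n≥2 =
  Δ-induced _ n O-light , Δ-induced _ n I-light ,
  deg-zeroWord _ n O-light , deg-zeroWord _ n I-light ,
  OV-onlyZeroMaximal⇔ n p r p≥1 r≥1 n≥2 , IV-onlyZeroMaximal⇔ n p r p≥1 r≥1 n≥2
  where
    O-light : AcceptsLightWords (isOWord p r)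
    O-light = isOWord-light p r r≥1
    I-light : AcceptsLightWords (isIWord p r)
    I-light = isIWord-light p r r≥1
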